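{- Let $n$ be a positive integer and consider a sequence $a_1,\dots,a_n$ of values in $\{0,1,\dots,n,\infty\}$, initially $a_i=\infty$ for all $i$. Alice and Bob play $n$ turns; in each turn, first Alice decreases each $a_i$ by one (with $\infty-1=\infty$), and then for each $i$ with $a_i=0$ she pays one dollar and sets $a_i:=\infty$; then Bob chooses a sequence $b_1,\dots,b_n$ which, when sorted, equals $(1,2,\dots,c,\infty,\dots,\infty)$ for some $1\le c\le n$, and for each $i$ sets $a_i:=\min(a_i,b_i)$. Then, regardless of Bob's choices, Alice pays at most $2n\sqrt{n}$ dollars in total. -}

module Defs where

open import Data.Nat using (ℕ; zero; suc; _∸_; _≤_; _⊓_)
open import Data.Maybe using (Maybe; just; nothing)
open import Data.Product using (∃; _×_; _,_; proj₁)
open import Data.List as List using (List; _++_; upTo)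
open import Data.Vec as Vec using (Vec; []; _∷_)
open import Data.List.Relation.Binary.Permutation.Propositional using (_↭_)

ℕ∞ : Set
ℕ∞ = Maybe ℕ

∞ : ℕ∞
∞ = nothing

dec : ℕ∞ → ℕ∞
dec nothing  = nothing
dec (just k) = just (k ∸ 1)

min∞ : ℕ∞ → ℕ∞ → ℕ∞
min∞ nothing  y        = y
min∞ (just x) nothing  = just x
min∞ (just x) (just y) = just (x ⊓ y)

payOne : ℕ∞ → ℕ
payOne (just zero) = 1
payOne _           = 0

reset : ℕ∞ → ℕ∞
reset (just zero) = nothing
reset x           = x

sumVec : ∀ {n} → Vec ℕ n → ℕ
sumVec = Vec.foldr _ Data.Nat._+_ 0

target : ℕ → ℕ → List ℕ∞
target n c = List.map (λ k → just (suc k)) (upTo c) ++ List.replicate (n ∸ c) ∞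

-- Bob's move b is legal: when sorted it equals (1,...,c,∞,...,∞) for some 1 ≤ c ≤ n,
-- i.e. b is a rearrangement of that sorted sequence.
ValidBob : (n : ℕ) → Vec ℕ∞ n → Set
ValidBob n b = ∃ λ c → (1 ≤ c) × (c ≤ n) × (Vec.toList b ↭ target n c)

turn : ∀ {n} → Vec ℕ∞ n → Vec ℕ∞ n → ℕ × Vec ℕ∞ n
turn a b =
  let a′ = Vec.map dec a
  in sumVec (Vec.map payOne a′) , Vec.zipWith min∞ (Vec.map reset a′) b

totalPay : ∀ {n m} → Vec ℕ∞ n → Vec (Vec ℕ∞ n) m → ℕ
totalPay a []       = 0
totalPay a (b ∷ bs) with turn a b
... | p , a′ = p Data.Nat.+ totalPay a′ bs

initial : ∀ n → Vec ℕ∞ n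
initial n = Vec.replicate n ∞

{-# OPTIONS --safe #-}
module Submission where

-- Fix k = ⌊√n⌋ and charge each entry a the potential φ a = (k + 1) ∸ a (and 0 for ∞).
-- Alice's decrement raises the total potential by at most n per turn, while each
-- dollar she pays is an entry leaving potential k + 1 for ∞, so it releases k + 1.
-- Bob's sequence carries potential at most k + (k - 1) + … + 1 = k(k+1)/2 ≤ n, and
-- min never exceeds the sum of the potentials.  Over n turns this gives
-- (k + 1) · paid ≤ 2n², and (k + 1)² > n turns it into paid² ≤ 4n³.

open import Defs
open import Data.Nat using (ℕ; _≤_; _*_)
open import Data.Vec using (Vec)
open import Data.Vec.Relation.Unary.All using (All)

open import Data.Nat using (zero; suc; _+_; _∸_; _<_; z≤n; s≤s)
open import Data.Nat.Properties
open import Data.Nat.ListAction using (sum)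
open import Data.Nat.ListAction.Properties using (sum-++; sum-↭)
open import Data.Nat.Tactic.RingSolver using (solve-∀)
open import Data.Maybe using (just; nothing)
open import Data.Product using (∃; _×_; _,_; proj₁; proj₂)
open import Data.Sum using (inj₁; inj₂)
open import Data.List as List using (List; _++_; applyUpTo; upTo)
open import Data.List.Properties using (map-++; map-upTo; map-applyUpTo)
open import Data.List.Relation.Binary.Permutation.Propositional.Properties using (map⁺)
import Data.Vec as Vec
open import Data.Vec.Properties using (toList-replicate)
open import Data.Vec.Relation.Unary.All using ([]; _∷_)
open import Function using (_∘_)
open import Relation.Binary.PropositionalEquality using (_≡_; refl; cong; trans; module ≡-Reasoning)

triangle : ℕ → ℕ
triangle zero    = 0
triangle (suc k) = suc k + triangle k

2*triangle : ∀ k → 2 * triangle k ≡ k * suc k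
2*triangle zero    = refl
2*triangle (suc k) = begin
  2 * (suc k + triangle k)   ≡⟨ *-distribˡ-+ 2 (suc k) (triangle k) ⟩
  2 * suc k + 2 * triangle k ≡⟨ cong (2 * suc k +_) (2*triangle k) ⟩
  2 * suc k + k * suc k      ≡⟨ *-distribʳ-+ (suc k) 2 k ⟨
  suc (suc k) * suc k        ≡⟨ *-comm (suc (suc k)) (suc k) ⟩
  suc k * suc (suc k)        ∎
  where open ≡-Reasoning

sum-applyUpTo≤triangle : ∀ {k} c (f : ℕ → ℕ) → (∀ j → f j ≤ k ∸ j) →
                         sum (applyUpTo f c) ≤ triangle k
sum-applyUpTo≤triangle zero    f f≤ = z≤n
sum-applyUpTo≤triangle {zero}  (suc c) f f≤ =
  +-mono-≤ (f≤ 0) (sum-applyUpTo≤triangle {0} c (λ j → f (suc j)) (λ j → ≤-trans (f≤ (suc j)) z≤n))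
sum-applyUpTo≤triangle {suc k} (suc c) f f≤ =
  +-mono-≤ (f≤ 0) (sum-applyUpTo≤triangle c (λ j → f (suc j)) (λ j → f≤ (suc j)))

floor-sqrt : ∀ n → ∃ λ k → k * k ≤ n × n < suc k * suc k
floor-sqrt zero = 0 , z≤n , s≤s z≤n
floor-sqrt (suc n) with floor-sqrt n
... | k , k²≤n , n<[k+1]² with m≤n⇒m<n∨m≡n n<[k+1]²
...   | inj₁ 1+n<[k+1]² = k , m≤n⇒m≤1+n k²≤n , 1+n<[k+1]²
...   | inj₂ refl       = suc k , ≤-refl , *-mono-< (n<1+n (suc k)) (n<1+n (suc k))

module Potential (k : ℕ) where

  φ : ℕ∞ → ℕ
  φ nothing  = 0
  φ (just v) = suc k ∸ v

  Φ : List ℕ∞ → ℕ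
  Φ xs = sum (List.map φ xs)

  Φ-replicate-∞ : ∀ m → Φ (List.replicate m ∞) ≡ 0
  Φ-replicate-∞ zero    = refl
  Φ-replicate-∞ (suc m) = Φ-replicate-∞ m

  φ-min∞ : ∀ x y → φ (min∞ x y) ≤ φ x + φ y
  φ-min∞ nothing  y        = ≤-refl
  φ-min∞ (just x) nothing  = m≤m+n (suc k ∸ x) 0
  φ-min∞ (just x) (just y) with ≤-total x y
  ... | inj₁ x≤y rewrite m≤n⇒m⊓n≡m x≤y = m≤m+n (suc k ∸ x) (suc k ∸ y)
  ... | inj₂ y≤x rewrite m≥n⇒m⊓n≡n y≤x = m≤n+m (suc k ∸ y) (suc k ∸ x)

  unpaid : ∀ m → suc k * 0 + m ≡ m
  unpaid m = cong (_+ m) (*-zeroʳ (suc k))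

  paid : suc k * 1 + 0 ≡ suc k
  paid = trans (+-identityʳ (suc k * 1)) (*-identityʳ (suc k))

  φ-payOne-reset-dec : ∀ x → suc k * payOne (dec x) + φ (reset (dec x)) ≤ φ x + 1
  φ-payOne-reset-dec nothing           = ≤-trans (≤-reflexive (unpaid 0)) z≤n
  φ-payOne-reset-dec (just zero)       = ≤-trans (≤-reflexive paid) (m≤m+n (suc k) 1)
  φ-payOne-reset-dec (just (suc zero)) = ≤-reflexive (trans paid (+-comm 1 k))
  φ-payOne-reset-dec (just (suc (suc v))) = begin
    suc k * 0 + (k ∸ v)   ≡⟨ unpaid (k ∸ v) ⟩
    k ∸ v                 ≤⟨ m∸n≤1+m∸[1+n] k v ⟩
    suc (k ∸ suc v)       ≡⟨ +-comm 1 (k ∸ suc v) ⟩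
    k ∸ suc v + 1         ∎
    where
    open ≤-Reasoning
    m∸n≤1+m∸[1+n] : ∀ m n → m ∸ n ≤ suc (m ∸ suc n)
    m∸n≤1+m∸[1+n] zero    zero    = z≤n
    m∸n≤1+m∸[1+n] zero    (suc n) = z≤n
    m∸n≤1+m∸[1+n] (suc m) zero    = ≤-refl
    m∸n≤1+m∸[1+n] (suc m) (suc n) = m∸n≤1+m∸[1+n] m n

  φ-turn : ∀ x y → suc k * payOne (dec x) + φ (min∞ (reset (dec x)) y) ≤ φ x + 1 + φ y
  φ-turn x y = begin
    cost + φ (min∞ x′ y)   ≤⟨ +-monoʳ-≤ cost (φ-min∞ x′ y) ⟩
    cost + (φ x′ + φ y)    ≡⟨ +-assoc cost (φ x′) (φ y) ⟨
    cost + φ x′ + φ y      ≤⟨ +-monoˡ-≤ (φ y) (φ-payOne-reset-dec x) ⟩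
    φ x + 1 + φ y          ∎
    where
    open ≤-Reasoning
    cost = suc k * payOne (dec x)
    x′   = reset (dec x)

  Φ-turn : ∀ {n} (a b : Vec ℕ∞ n) →
           suc k * proj₁ (turn a b) + Φ (Vec.toList (proj₂ (turn a b))) ≤
           Φ (Vec.toList a) + n + Φ (Vec.toList b)
  Φ-turn Vec.[] Vec.[] = ≤-reflexive (unpaid 0)
  Φ-turn {suc n} (x Vec.∷ a) (y Vec.∷ b) = begin
    suc k * (p + P) + (φ z + Φ a′)         ≡⟨ interchange (suc k) p P (φ z) (Φ a′) ⟩
    (suc k * p + φ z) + (suc k * P + Φ a′) ≤⟨ +-mono-≤ (φ-turn x y) (Φ-turn a b) ⟩
    (φ x + 1 + φ y) + (Φ as + n + Φ bs)    ≡⟨ regroup (φ x) (φ y) (Φ as) n (Φ bs) ⟩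
    φ x + Φ as + suc n + (φ y + Φ bs)      ∎
    where
    open ≤-Reasoning
    p  = payOne (dec x)
    P  = proj₁ (turn a b)
    z  = min∞ (reset (dec x)) y
    a′ = Vec.toList (proj₂ (turn a b))
    as = Vec.toList a
    bs = Vec.toList b
    interchange : ∀ K p P u v → K * (p + P) + (u + v) ≡ (K * p + u) + (K * P + v)
    interchange = solve-∀
    regroup : ∀ x y X n Y → (x + 1 + y) + (X + n + Y) ≡ x + X + suc n + (y + Y)
    regroup = solve-∀

  Φ-target : ∀ n c → Φ (target n c) ≤ triangle k
  Φ-target n c = begin
    Φ (ups ++ ∞s)                            ≡⟨ cong sum (map-++ φ ups ∞s) ⟩
    sum (List.map φ ups ++ List.map φ ∞s)    ≡⟨ sum-++ (List.map φ ups) (List.map φ ∞s) ⟩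
    Φ ups + Φ ∞s                             ≡⟨ cong (Φ ups +_) (Φ-replicate-∞ (n ∸ c)) ⟩
    Φ ups + 0                                ≡⟨ +-identityʳ (Φ ups) ⟩
    Φ ups                                    ≡⟨ cong (sum ∘ List.map φ) (map-upTo just∘suc c) ⟩
    sum (List.map φ (applyUpTo just∘suc c))  ≡⟨ cong sum (map-applyUpTo just∘suc φ c) ⟩
    sum (applyUpTo (k ∸_) c)                 ≤⟨ sum-applyUpTo≤triangle c (k ∸_) (λ _ → ≤-refl) ⟩
    triangle k                               ∎
    where
    open ≤-Reasoning
    just∘suc = λ j → just (suc j)
    ups = List.map just∘suc (upTo c)
    ∞s  = List.replicate (n ∸ c) ∞

  Φ-valid : ∀ {n} (b : Vec ℕ∞ n) → ValidBob n b → Φ (Vec.toList b) ≤ triangle k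
  Φ-valid {n} b (c , _ , _ , b↭target) =
    ≤-trans (≤-reflexive (sum-↭ (map⁺ φ b↭target))) (Φ-target n c)

  Φ-initial : ∀ n → Φ (Vec.toList (initial n)) ≡ 0
  Φ-initial n = trans (cong Φ (toList-replicate n ∞)) (Φ-replicate-∞ n)

  Φ-totalPay : ∀ {n m} (a : Vec ℕ∞ n) (bs : Vec (Vec ℕ∞ n) m) → All (ValidBob n) bs →
               suc k * totalPay a bs ≤ Φ (Vec.toList a) + m * (n + triangle k)
  Φ-totalPay a Vec.[] [] = ≤-trans (≤-reflexive (*-zeroʳ (suc k))) z≤n
  Φ-totalPay {n} {suc m} a (b Vec.∷ bs) (b-valid ∷ bs-valid) = begin
    suc k * (p + T)                      ≡⟨ *-distribˡ-+ (suc k) p T ⟩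
    suc k * p + suc k * T                ≤⟨ +-monoʳ-≤ (suc k * p) (Φ-totalPay a′ bs bs-valid) ⟩
    suc k * p + (Φ (Vec.toList a′) + M)  ≡⟨ +-assoc (suc k * p) (Φ (Vec.toList a′)) M ⟨
    suc k * p + Φ (Vec.toList a′) + M    ≤⟨ +-monoˡ-≤ M (Φ-turn a b) ⟩
    Φ as + n + Φ (Vec.toList b) + M      ≤⟨ +-monoˡ-≤ M (+-monoʳ-≤ (Φ as + n) (Φ-valid b b-valid)) ⟩
    Φ as + n + triangle k + M            ≡⟨ cong (_+ M) (+-assoc (Φ as) n (triangle k)) ⟩
    Φ as + (n + triangle k) + M          ≡⟨ +-assoc (Φ as) (n + triangle k) M ⟩
    Φ as + suc m * (n + triangle k)      ∎
    where
    open ≤-Reasoning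
    p  = proj₁ (turn a b)
    a′ = proj₂ (turn a b)
    T  = totalPay a′ bs
    M  = m * (n + triangle k)
    as = Vec.toList a

m≤m*m : ∀ m → m ≤ m * m
m≤m*m zero    = z≤n
m≤m*m (suc m) = m≤m*n (suc m) (suc m)

triangle≤ : ∀ k {n} → k * k ≤ n → triangle k ≤ n
triangle≤ k {n} k²≤n = *-cancelˡ-≤ 2 (begin
  2 * triangle k   ≡⟨ 2*triangle k ⟩
  k * suc k        ≡⟨ *-suc k k ⟩
  k + k * k        ≤⟨ +-mono-≤ (≤-trans (m≤m*m k) k²≤n) k²≤n ⟩
  n + n            ≡⟨ cong (n +_) (+-identityʳ n) ⟨
  2 * n            ∎)
  where open ≤-Reasoning

square-bound : ∀ n k P → suc k * P ≤ n * (n + n) → n < suc k * suc k → P * P ≤ 4 * (n * n * n)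
square-bound n k P KP≤ n<K² = *-cancelˡ-≤ (K * K) (begin
  K * K * (P * P)                 ≡⟨ interchange K P ⟩
  (K * P) * (K * P)               ≤⟨ *-mono-≤ KP≤ KP≤ ⟩
  n * (n + n) * (n * (n + n))     ≡⟨ expand n ⟩
  4 * (n * n * n) * n             ≤⟨ *-monoʳ-≤ (4 * (n * n * n)) (<⇒≤ n<K²) ⟩
  4 * (n * n * n) * (K * K)       ≡⟨ *-comm (4 * (n * n * n)) (K * K) ⟩
  K * K * (4 * (n * n * n))       ∎)
  where
  open ≤-Reasoning
  K = suc k
  interchange : ∀ K P → K * K * (P * P) ≡ (K * P) * (K * P)
  interchange = solve-∀
  expand : ∀ n → n * (n + n) * (n * (n + n)) ≡ 4 * (n * n * n) * n
  expand = solve-∀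

lemma17 : (n : ℕ) → 1 ≤ n → (bs : Vec (Vec ℕ∞ n) n) → All (ValidBob n) bs →
            totalPay (initial n) bs * totalPay (initial n) bs ≤ 4 * (n * n * n)
lemma17 n _ bs bs-valid with floor-sqrt n
... | k , k²≤n , n<[k+1]² = square-bound n k (totalPay (initial n) bs) paid≤ n<[k+1]²
  where
  open Potential k
  paid≤ : suc k * totalPay (initial n) bs ≤ n * (n + n)
  paid≤ = begin
    suc k * totalPay (initial n) bs                    ≤⟨ Φ-totalPay (initial n) bs bs-valid ⟩
    Φ (Vec.toList (initial n)) + n * (n + triangle k)  ≡⟨ cong (_+ n * (n + triangle k)) (Φ-initial n) ⟩
    n * (n + triangle k)                               ≤⟨ *-monoʳ-≤ n (+-monoʳ-≤ n (triangle≤ k k²≤n)) ⟩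
    n * (n + n)                                        ∎
    where open ≤-Reasoning
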